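{- Let $k\ge1$, $n\ge1$, and let $T$ be an array with $k+1$ rows and $n$ columns filled with the labels $1,2,\dots,(k+1)n$, each used once, such that each row increases from left to right and each column increases from top to bottom. Then $T=T(D)$ for some Dyck path $D\in\mathcal D_{kn+1,n}$ if and only if for any labels $a<b<c<d$ with $d$ immediately below $a$ (same column, next row), the labels $b$ and $c$ are never in the same column.
   Context: $\mathcal D_{m,n}$ (coprime $m,n$) is the set of lattice paths from $(0,0)$ to $(m,n)$ with unit North and East steps staying weakly above the segment from $(0,0)$ to $(m,n)$; $\mathrm{SW}(D)$ is its step word ($S$ for North, $W$ for East). For $m=kn+1$, $T(D)$ is the array with $k+1$ rows and $n$ columns obtained by the filling algorithm: place $1$ at the top of column 1; for $i=2,\dots,m+n-1$, if the $i$-th letter of $\mathrm{SW}(D)$ is $S$ place $i$ at the top of the leftmost empty column, and if $W$ place $i$ immediately below the smallest active entry, where an entry is active if it is currently the lowest entry of its column and is not in row $k+1$. -}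

module Defs where

open import Data.Nat using (ℕ; zero; suc; _+_; _*_; _∸_; _≤_; _<_; _≤ᵇ_; _<ᵇ_)
open import Data.Bool using (Bool; true; false; if_then_else_)
open import Data.List using (List; []; _∷_; _++_; length; map; take; drop; replicate; last)
open import Data.Maybe using (Maybe; just; nothing)
open import Data.Product using (Σ; _×_; _,_; ∃-syntax)
open import Data.Fin as Fin using (Fin; inject₁)
import Data.Fin.Base
open import Data.Vec as Vec using ()
open import Relation.Binary.PropositionalEquality using (_≡_; _≢_)

data Step : Set where
  N E : Step

#N #E : List Step → ℕ
#N []       = 0
#N (N ∷ w)  = suc (#N w)
#N (E ∷ w)  = #N w
#E []       = 0
#E (E ∷ w)  = suc (#E w)
#E (N ∷ w)  = #E w

-- A step list is a path from (0,0) to (m,n) staying weakly above the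
-- segment from (0,0) to (m,n): every lattice point (x,y) it visits
-- (i.e. the endpoint of every prefix, x = #E, y = #N) satisfies
-- y ≥ (n/m)·x, i.e. n·x ≤ m·y.
record IsDyck (m n : ℕ) (w : List Step) : Set where
  field
    east-count  : #E w ≡ m
    north-count : #N w ≡ n
    above       : ∀ (p q : List Step) → w ≡ p ++ q → n * #E p ≤ m * #N p

Dyck : ℕ → ℕ → Set
Dyck m n = Σ (List Step) (IsDyck m n)

data Letter : Set where
  S W : Letter

SW : ∀ {m n} → Dyck m n → List Letter
SW (w , _) = map f w
  where
  f : Step → Letter
  f N = S
  f E = W

-- The filling algorithm.  A (partial) array with n columns is a list of
-- n columns, each column the list of its entries from top to bottom.

Columns : Set
Columns = List (List ℕ)

placeS : ℕ → Columns → Maybe Columns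
placeS i []            = nothing
placeS i ([] ∷ cs)     = just ((i ∷ []) ∷ cs)
placeS i ((x ∷ c) ∷ cs) with placeS i cs
... | just cs' = just ((x ∷ c) ∷ cs')
... | nothing  = nothing

-- the active entry of a column (with k+1 rows): its lowest entry,
-- provided the column is nonempty and that entry is not in row k+1,
-- i.e. the column has at most k entries
activeEntry : ℕ → List ℕ → Maybe ℕ
activeEntry k c = if length c ≤ᵇ k then last c else nothing

smallestActive : ℕ → Columns → Maybe (ℕ × ℕ)
smallestActive k []       = nothing
smallestActive k (c ∷ cs) with activeEntry k c | smallestActive k cs
... | nothing | nothing        = nothing
... | nothing | just (j , v)   = just (suc j , v)
... | just a  | nothing        = just (0 , a)
... | just a  | just (j , v)   = if v <ᵇ a then just (suc j , v) else just (0 , a)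

appendAt : ℕ → ℕ → Columns → Columns
appendAt j i []             = []
appendAt zero i (c ∷ cs)    = (c ++ (i ∷ [])) ∷ cs
appendAt (suc j) i (c ∷ cs) = c ∷ appendAt j i cs

placeW : ℕ → ℕ → Columns → Maybe Columns
placeW k i cs with smallestActive k cs
... | nothing      = nothing
... | just (j , _) = just (appendAt j i cs)

run : ℕ → ℕ → List Letter → Columns → Maybe Columns
run k i []        cs = just cs
run k i (S ∷ ls)  cs with placeS i cs
... | nothing  = nothing
... | just cs' = run k (suc i) ls cs'
run k i (W ∷ ls)  cs with placeW k i cs
... | nothing  = nothing
... | just cs' = run k (suc i) ls cs'

initial : ℕ → Columns
initial n = (1 ∷ []) ∷ replicate (n ∸ 1) []

-- filling algorithm for m = kn+1: letters i = 2, …, m+n-1 of the word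
-- (i.e. drop the first letter, keep the next m+n-2 letters);
-- returns nothing if some step cannot be performed.
fill : (k n : ℕ) → List Letter → Maybe Columns
fill k n ws = run k 2 (take ((suc (k * n) + n) ∸ 2) (drop 1 ws)) (initial n)

T[_] : ∀ {k n} → Dyck (suc (k * n)) n → Maybe Columns
T[_] {k} {n} D = fill k n (SW D)

-- Arrays with k+1 rows and n columns: T r c = entry in row r, column c

Array : ℕ → ℕ → Set
Array k n = Fin (suc k) → Fin n → ℕ

columnsOf : ∀ {k n} → Array k n → Columns
columnsOf {k} {n} T =
  Vec.toList (Vec.tabulate (λ c → Vec.toList (Vec.tabulate (λ r → T r c))))

record IsStandard {k n : ℕ} (T : Array k n) : Set where
  field
    inRange    : ∀ r c → 1 ≤ T r c × T r c ≤ suc k * n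
    injective  : ∀ r c r' c' → T r c ≡ T r' c' → (r ≡ r') × (c ≡ c')
    surjective : ∀ ℓ → 1 ≤ ℓ → ℓ ≤ suc k * n → ∃[ r ] ∃[ c ] (T r c ≡ ℓ)
    rowsInc    : ∀ r c c' → c Fin.< c' → T r c < T r c'
    colsInc    : ∀ r r' c → r Fin.< r' → T r c < T r' c

PatternCondition : ∀ {k n} → Array k n → Set
PatternCondition {k} {n} T =
  ∀ (r : Fin k) (j : Fin n) →
    let a = T (inject₁ r) j
        d = T (Fin.suc r) j
    in ∀ (rb rc : Fin (suc k)) (cb cc : Fin n) → a < T rb cb → T rb cb < T rc cc → T rc cc < d → cb ≢ cc

-- Write T<i for T restricted to the labels below i. The filling algorithm only
-- appends entries to columns, so if it produces T then its state before label i
-- is T<i, and every label i = T(r+1, j) was placed under the smallest active entry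
-- of T<i, which must be its upper neighbour T(r, j). For a < b < c < d with d below
-- a and b above c in one column, a is still active when c is placed while the entry
-- above c is at least b > a; so the pattern cannot occur. Conversely, read off the
-- word whose i-th step is N if i lies in the top row and E otherwise, followed by a
-- final E. The pattern condition makes the upper neighbour of every lower label the
-- smallest active entry of T<i, so filling along this word rebuilds T; and the word
-- stays above the diagonal since each occupied column of T<i holds at most k labels
-- besides its top one, i.e. #E ≤ k · #N after every step.

module Submission where

open import Defs
open import Data.Bool using (true; false) renaming (T to True)
open import Data.Fin as Fin using (Fin; inject₁; toℕ)
open import Data.Fin.Properties using (toℕ-inject₁; toℕ-injective; toℕ<n; any?)
  renaming (suc-injective to Fin-suc-injective)
open import Data.List using (List; []; _∷_; _++_; [_]; length; map; take; drop; replicate; last; tabulate; filter)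
open import Data.Nat.ListAction using (sum)
open import Data.List.Properties
  using (filter-accept; filter-reject; filter-all; filter-none; length-filter; ++-assoc; ++-identityʳ;
         tabulate-cong; length-tabulate; take-map; ∷-injective; ∷-injectiveˡ; ∷-injectiveʳ; length-++; map-cong)
open import Data.List.Relation.Unary.All using (All; []; _∷_)
open import Data.List.Relation.Unary.All.Properties using (tabulate⁺; tabulate⁻; all-filter)
open import Data.List.Relation.Unary.Any using (here; there)
open import Data.List.Membership.Propositional using (_∈_; _∉_)
open import Data.List.Membership.Propositional.Properties using (∈-tabulate⁻; ∈-++⁺ʳ)
open import Data.List.Relation.Binary.Pointwise as Pointwise using (Pointwise; []; _∷_)
open import Data.Maybe using (just; nothing)
open import Data.Maybe.Properties using (just-injective)
open import Data.Nat using (ℕ; zero; suc; _+_; _*_; _∸_; _≤_; _<_; _≤ᵇ_; _<ᵇ_; z≤n; s≤s; _<?_; _≟_)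
open import Data.Nat.Properties
open import Data.Product using (_×_; _,_; ∃-syntax; proj₁; proj₂)
open import Data.Sum using (_⊎_; inj₁; inj₂)
import Data.Vec as Vec
open import Function using (_∘_)
open import Function.Bundles using (_⇔_; mk⇔)
open import Relation.Binary using (_Preserves_⟶_; tri<; tri≈; tri>)
open import Relation.Binary.PropositionalEquality
  using (_≡_; _≢_; refl; sym; trans; cong; cong₂; subst; subst₂; module ≡-Reasoning)
open import Relation.Nullary using (yes; no; ¬_; contradiction)

toList-tabulate : ∀ {n} {A : Set} (f : Fin n → A) → Vec.toList (Vec.tabulate f) ≡ tabulate f
toList-tabulate {zero}  f = refl
toList-tabulate {suc n} f = cong (f Fin.zero ∷_) (toList-tabulate (f ∘ Fin.suc))

tabulate-injective : ∀ {n} {A : Set} {f g : Fin n → A} → tabulate f ≡ tabulate g → ∀ x → f x ≡ g x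
tabulate-injective {suc n} e Fin.zero    = proj₁ (∷-injective e)
tabulate-injective {suc n} e (Fin.suc x) = tabulate-injective (∷-injectiveʳ e) x

tabulate-const : ∀ {n} {A : Set} (a : A) → tabulate {n = n} (λ _ → a) ≡ replicate n a
tabulate-const {zero}  a = refl
tabulate-const {suc n} a = cong (a ∷_) (tabulate-const a)

take-length-++ : ∀ {A : Set} (xs ys : List A) → take (length xs) (xs ++ ys) ≡ xs
take-length-++ []       ys = refl
take-length-++ (x ∷ xs) ys = cong (x ∷_) (take-length-++ xs ys)

last-∷ : ∀ {A : Set} {x a : A} xs → last (x ∷ xs) ≡ just a → (xs ≡ [] × x ≡ a) ⊎ last xs ≡ just a
last-∷ []      refl = inj₁ (refl , refl)
last-∷ (_ ∷ _) e    = inj₂ e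

last-∷-nonempty : ∀ {A : Set} {x : A} {n} xs → length xs ≡ suc n → last (x ∷ xs) ≡ last xs
last-∷-nonempty (_ ∷ _) _ = refl

Increasing : ∀ {m} → (Fin m → ℕ) → Set
Increasing g = g Preserves Fin._<_ ⟶ _<_

Increasing-suc : ∀ {m} {g : Fin (suc m) → ℕ} → Increasing g → Increasing (g ∘ Fin.suc)
Increasing-suc inc p<q = inc (s≤s p<q)

Increasing-mono : ∀ {m} {g : Fin m → ℕ} → Increasing g → g Preserves Fin._≤_ ⟶ _≤_
Increasing-mono inc p≤q with m≤n⇒m<n∨m≡n p≤q
... | inj₁ p<q = <⇒≤ (inc p<q)
... | inj₂ p≡q rewrite toℕ-injective p≡q = ≤-refl

Increasing-cancel : ∀ {m} {g : Fin m → ℕ} → Increasing g → ∀ {p q} → g p < g q → p Fin.< q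
Increasing-cancel inc gp<gq = ≰⇒> (λ q≤p → <⇒≱ gp<gq (Increasing-mono inc q≤p))

below : ℕ → List ℕ → List ℕ
below c = filter (_<? c)

module _ {m : ℕ} {g : Fin m → ℕ} where

  below-all : ∀ {c} → (∀ p → g p < c) → below c (tabulate g) ≡ tabulate g
  below-all g<c = filter-all (_<? _) (tabulate⁺ g<c)

  below-none : ∀ {c} → (∀ p → c ≤ g p) → below c (tabulate g) ≡ []
  below-none c≤g = filter-none (_<? _) (tabulate⁺ (≤⇒≯ ∘ c≤g))

  below-all⁻ : ∀ {c} → below c (tabulate g) ≡ tabulate g → ∀ p → g p < c
  below-all⁻ e = tabulate⁻ (subst (All _) e (all-filter (_<? _) (tabulate g)))

below-∷ : ∀ {x c} xs → x < c → below c (x ∷ xs) ≡ x ∷ below c xs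
below-∷ xs = filter-accept (_<? _) {xs = xs}

below-∷-≥ : ∀ {x c} xs → c ≤ x → below c (x ∷ xs) ≡ below c xs
below-∷-≥ xs c≤x = filter-reject (_<? _) {xs = xs} (≤⇒≯ c≤x)

below-suc-∉ : ∀ {i} xs → i ∉ xs → below (suc i) xs ≡ below i xs
below-suc-∉ [] _ = refl
below-suc-∉ {i} (x ∷ xs) i∉ with <-cmp x i
... | tri< x<i _ _ rewrite below-∷ {c = suc i} xs (m<n⇒m<1+n x<i) | below-∷ xs x<i =
  cong (x ∷_) (below-suc-∉ xs (i∉ ∘ there))
... | tri≈ _ x≡i _ = contradiction (here (sym x≡i)) i∉
... | tri> _ _ i<x rewrite below-∷-≥ {c = suc i} xs i<x | below-∷-≥ xs (<⇒≤ i<x) =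
  below-suc-∉ xs (i∉ ∘ there)

below-suc-tabulate : ∀ {m} {g : Fin m → ℕ} → Increasing g → ∀ r →
  below (suc (g r)) (tabulate g) ≡ below (g r) (tabulate g) ++ [ g r ]
below-suc-tabulate {suc m} {g} inc Fin.zero
  rewrite below-∷ (tabulate (g ∘ Fin.suc)) (n<1+n (g Fin.zero))
        | below-∷-≥ (tabulate (g ∘ Fin.suc)) (≤-refl {g Fin.zero})
        | below-none {g = g ∘ Fin.suc} (λ p → inc {Fin.zero} {Fin.suc p} (s≤s z≤n))
        | below-none {g = g ∘ Fin.suc} (λ p → <⇒≤ (inc {Fin.zero} {Fin.suc p} (s≤s z≤n)))
  = refl
below-suc-tabulate {suc m} {g} inc (Fin.suc r)
  rewrite below-∷ {c = suc (g (Fin.suc r))} (tabulate (g ∘ Fin.suc)) (m<n⇒m<1+n (inc (s≤s z≤n)))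
        | below-∷ (tabulate (g ∘ Fin.suc)) (inc {Fin.zero} {Fin.suc r} (s≤s z≤n))
  = cong (g Fin.zero ∷_) (below-suc-tabulate (Increasing-suc inc) r)

below-last : ∀ {m} {g : Fin (suc m) → ℕ} → Increasing g → ∀ {c} (r : Fin m) →
  g (inject₁ r) < c → c ≤ g (Fin.suc r) →
  length (below c (tabulate g)) ≡ suc (toℕ r) × last (below c (tabulate g)) ≡ just (g (inject₁ r))
below-last {suc m} {g} inc Fin.zero gr<c c≤gr′
  rewrite below-∷ (tabulate (g ∘ Fin.suc)) gr<c
        | below-none {g = g ∘ Fin.suc}
            (λ p → ≤-trans c≤gr′ (Increasing-mono inc {Fin.suc Fin.zero} {Fin.suc p} (s≤s z≤n)))
  = refl , refl
below-last {suc m} {g} inc {c} (Fin.suc r) gr<c c≤gr′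
  rewrite below-∷ (tabulate (g ∘ Fin.suc)) (<-trans (inc (s≤s z≤n)) gr<c)
  with below-last (Increasing-suc inc) r gr<c c≤gr′
... | len , lst = cong suc len , trans (last-∷-nonempty {x = g Fin.zero} (below c (tabulate (g ∘ Fin.suc))) len) lst

below-last⁻ : ∀ {m} {g : Fin (suc m) → ℕ} → Increasing g → ∀ {c a} →
  length (below c (tabulate g)) ≤ m → last (below c (tabulate g)) ≡ just a →
  ∃[ s ] g (inject₁ s) ≡ a × c ≤ g (Fin.suc s)
below-last⁻ {m} {g} inc {c} len lst with g Fin.zero <? c
... | no g₀≮c = contradiction (trans (sym lst) (cong last none)) λ ()
  where
  none : below c (tabulate g) ≡ []
  none = below-none (λ p → ≤-trans (≮⇒≥ g₀≮c) (Increasing-mono inc {Fin.zero} {p} z≤n))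
... | yes g₀<c
  with subst (λ l → length l ≤ m) (below-∷ (tabulate (g ∘ Fin.suc)) g₀<c) len
     | last-∷ (below c (tabulate (g ∘ Fin.suc)))
               (trans (cong last (sym (below-∷ (tabulate (g ∘ Fin.suc)) g₀<c))) lst)
... | s≤s _ | inj₁ (rest≡[] , g₀≡a) =
  Fin.zero , g₀≡a ,
  ≮⇒≥ (λ g₁<c → contradiction (trans (sym (below-∷ (tabulate (g ∘ Fin.suc ∘ Fin.suc)) g₁<c)) rest≡[]) λ ())
... | s≤s len′ | inj₂ lst′ with below-last⁻ (Increasing-suc inc) len′ lst′
... | s , gs≡a , c≤gs′ = Fin.suc s , gs≡a , c≤gs′

activeEntry⁻ : ∀ {k c a} → activeEntry k c ≡ just a → length c ≤ k × last c ≡ just a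
activeEntry⁻ {k} {c} e with length c ≤ᵇ k in le
... | true = ≤ᵇ⇒≤ (length c) k (subst True (sym le) _) , e

activeEntry⁺ : ∀ {k c a} → length c ≤ k → last c ≡ just a → activeEntry k c ≡ just a
activeEntry⁺ {k} {c} len lst with length c ≤ᵇ k in le
... | true  = lst
... | false = contradiction (≤⇒≤ᵇ len) (subst True le)

_⊑_ : List ℕ → List ℕ → Set
c ⊑ c′ = ∃[ r ] c′ ≡ c ++ r

⊑-refl : ∀ {c} → c ⊑ c
⊑-refl {c} = [] , sym (++-identityʳ c)

⊑-trans : ∀ {c c′ c″} → c ⊑ c′ → c′ ⊑ c″ → c ⊑ c″
⊑-trans {c} (r , refl) (r′ , refl) = r ++ r′ , ++-assoc c r r′

_⊑ᶜ_ : Columns → Columns → Set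
_⊑ᶜ_ = Pointwise _⊑_

⊑ᶜ-refl : ∀ {cs} → cs ⊑ᶜ cs
⊑ᶜ-refl = Pointwise.refl ⊑-refl

⊑ᶜ-trans : ∀ {cs cs′ cs″} → cs ⊑ᶜ cs′ → cs′ ⊑ᶜ cs″ → cs ⊑ᶜ cs″
⊑ᶜ-trans = Pointwise.transitive ⊑-trans

⊑ᶜ-appendAt : ∀ j i cs → cs ⊑ᶜ appendAt j i cs
⊑ᶜ-appendAt j       i []       = []
⊑ᶜ-appendAt zero    i (c ∷ cs) = ([ i ] , refl) ∷ ⊑ᶜ-refl
⊑ᶜ-appendAt (suc j) i (c ∷ cs) = ⊑-refl ∷ ⊑ᶜ-appendAt j i cs

placeS⁻ : ∀ {i cs cs′} → placeS i cs ≡ just cs′ → ∃[ j ] cs′ ≡ appendAt j i cs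
placeS⁻ {i} {[] ∷ cs}      refl = zero , refl
placeS⁻ {i} {(x ∷ c) ∷ cs} e with placeS i cs in e′
placeS⁻ {i} {(x ∷ c) ∷ cs} refl | just _ with j , refl ← placeS⁻ {i} {cs} e′ = suc j , refl

placeW⁻ : ∀ {k i cs cs′} → placeW k i cs ≡ just cs′ →
  ∃[ j ] ∃[ v ] smallestActive k cs ≡ just (j , v) × cs′ ≡ appendAt j i cs
placeW⁻ {k} {i} {cs} e with smallestActive k cs
placeW⁻ refl | just (j , v) = j , v , refl , refl

placeW⁺ : ∀ {k i cs j v} → smallestActive k cs ≡ just (j , v) → placeW k i cs ≡ just (appendAt j i cs)
placeW⁺ e rewrite e = refl

run-S⁻ : ∀ {k i ls cs F} → run k i (S ∷ ls) cs ≡ just F →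
  ∃[ cs′ ] placeS i cs ≡ just cs′ × run k (suc i) ls cs′ ≡ just F
run-S⁻ {k} {i} {ls} {cs} e with placeS i cs
... | just cs′ = cs′ , refl , e

run-W⁻ : ∀ {k i ls cs F} → run k i (W ∷ ls) cs ≡ just F →
  ∃[ cs′ ] placeW k i cs ≡ just cs′ × run k (suc i) ls cs′ ≡ just F
run-W⁻ {k} {i} {ls} {cs} e with placeW k i cs
... | just cs′ = cs′ , refl , e

run-S : ∀ {k i ls cs cs′ R} → placeS i cs ≡ just cs′ → run k (suc i) ls cs′ ≡ R → run k i (S ∷ ls) cs ≡ R
run-S e₁ e₂ rewrite e₁ = e₂

run-W : ∀ {k i ls cs cs′ R} → placeW k i cs ≡ just cs′ → run k (suc i) ls cs′ ≡ R → run k i (W ∷ ls) cs ≡ R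
run-W e₁ e₂ rewrite e₁ = e₂

run-⊑ᶜ : ∀ {k i} ls {cs F} → run k i ls cs ≡ just F → cs ⊑ᶜ F
run-⊑ᶜ []       refl = ⊑ᶜ-refl
run-⊑ᶜ {k} {i} (S ∷ ls) {cs} e with _ , e₁ , e₂ ← run-S⁻ {k} {i} {ls} {cs} e
  with j , refl ← placeS⁻ {i} {cs} e₁ = ⊑ᶜ-trans (⊑ᶜ-appendAt j i cs) (run-⊑ᶜ ls e₂)
run-⊑ᶜ {k} {i} (W ∷ ls) {cs} e with _ , e₁ , e₂ ← run-W⁻ {k} {i} {ls} {cs} e
  with j , _ , _ , refl ← placeW⁻ {k} {i} {cs} e₁ = ⊑ᶜ-trans (⊑ᶜ-appendAt j i cs) (run-⊑ᶜ ls e₂)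

appendAt-tabulate : ∀ {n} {f g : Fin n → List ℕ} j {i} → g j ≡ f j ++ [ i ] → (∀ x → x ≢ j → g x ≡ f x) →
  appendAt (toℕ j) i (tabulate f) ≡ tabulate g
appendAt-tabulate Fin.zero    gj others =
  cong₂ _∷_ (sym gj) (sym (tabulate-cong (λ x → others (Fin.suc x) λ ())))
appendAt-tabulate (Fin.suc j) gj others =
  cong₂ _∷_ (sym (others Fin.zero λ ()))
            (appendAt-tabulate j gj (λ x x≢j → others (Fin.suc x) (x≢j ∘ Fin-suc-injective)))

appendAt-⊑ᶜ-tabulate⁻ : ∀ {n} {f g : Fin n → List ℕ} j {i} → appendAt (toℕ j) i (tabulate f) ⊑ᶜ tabulate g →
  ∃[ r ] g j ≡ f j ++ i ∷ r
appendAt-⊑ᶜ-tabulate⁻ {f = f} Fin.zero {i} ((r , e) ∷ _) = r , trans e (++-assoc (f Fin.zero) [ i ] r)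
appendAt-⊑ᶜ-tabulate⁻ (Fin.suc j) (_ ∷ p) = appendAt-⊑ᶜ-tabulate⁻ j p

placeS-tabulate⁻ : ∀ {n i} {f : Fin n → List ℕ} {cs′} → placeS i (tabulate f) ≡ just cs′ →
  ∃[ j ] f j ≡ [] × cs′ ≡ appendAt (toℕ j) i (tabulate f)
placeS-tabulate⁻ {suc n} {i} {f} e with f Fin.zero in f₀≡
placeS-tabulate⁻ refl | [] = Fin.zero , f₀≡ , refl
placeS-tabulate⁻ {suc n} {i} {f} e | _ ∷ _ with placeS i (tabulate (f ∘ Fin.suc)) in e′
placeS-tabulate⁻ {f = f} refl | _ ∷ _ | just _ with j , fj≡[] , refl ← placeS-tabulate⁻ {f = f ∘ Fin.suc} e′ =
  Fin.suc j , fj≡[] , refl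

placeS-tabulate : ∀ {n i} {f : Fin n → List ℕ} j → f j ≡ [] → (∀ x → x Fin.< j → f x ≢ []) →
  placeS i (tabulate f) ≡ just (appendAt (toℕ j) i (tabulate f))
placeS-tabulate {f = f} Fin.zero fj≡[] _ rewrite fj≡[] = refl
placeS-tabulate {suc n} {i} {f} (Fin.suc j) fj≡[] earlier with f Fin.zero in f₀≡
... | []    = contradiction f₀≡ (earlier Fin.zero (s≤s z≤n))
... | _ ∷ _ rewrite placeS-tabulate {i = i} {f = f ∘ Fin.suc} j fj≡[] (λ x x<j → earlier (Fin.suc x) (s≤s x<j)) = refl

<ᵇ-true⇒< : ∀ {m n} → (m <ᵇ n) ≡ true → m < n
<ᵇ-true⇒< {m} {n} e = <ᵇ⇒< m n (subst True (sym e) _)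

<ᵇ-false⇒≥ : ∀ {m n} → (m <ᵇ n) ≡ false → n ≤ m
<ᵇ-false⇒≥ e = ≮⇒≥ (subst True e ∘ <⇒<ᵇ)

ActiveLowerBound : ℕ → ∀ {n} → (Fin n → List ℕ) → ℕ → Set
ActiveLowerBound k f v = ∀ x {a} → activeEntry k (f x) ≡ just a → v ≤ a

ActiveLowerBound-∷ : ∀ {k n} {f : Fin (suc n) → List ℕ} {v} →
  (∀ {a} → activeEntry k (f Fin.zero) ≡ just a → v ≤ a) → ActiveLowerBound k (f ∘ Fin.suc) v →
  ActiveLowerBound k f v
ActiveLowerBound-∷ head _    Fin.zero    = head
ActiveLowerBound-∷ _    tail (Fin.suc x) = tail x

smallestActive-nothing : ∀ {k n} {f : Fin n → List ℕ} → smallestActive k (tabulate f) ≡ nothing →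
  ∀ x → activeEntry k (f x) ≡ nothing
smallestActive-nothing {k} {suc n} {f} e x
  with activeEntry k (f Fin.zero) in e₀ | smallestActive k (tabulate (f ∘ Fin.suc)) in e₁
smallestActive-nothing e Fin.zero    | nothing | nothing = e₀
smallestActive-nothing e (Fin.suc x) | nothing | nothing = smallestActive-nothing e₁ x
smallestActive-nothing e x | just a | just (j , v) with v <ᵇ a
... | true  with () ← e
... | false with () ← e

smallestActive-tabulate⁻ : ∀ {k n} {f : Fin n → List ℕ} {m v} → smallestActive k (tabulate f) ≡ just (m , v) →
  ∃[ j ] toℕ j ≡ m × activeEntry k (f j) ≡ just v × ActiveLowerBound k f v
smallestActive-tabulate⁻ {k} {suc n} {f} e
  with activeEntry k (f Fin.zero) in e₀ | smallestActive k (tabulate (f ∘ Fin.suc)) in e₁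
... | nothing | just _ with refl ← e with j , j≡ , act , lb ← smallestActive-tabulate⁻ e₁ =
  Fin.suc j , cong suc j≡ , act , ActiveLowerBound-∷ {k} {f = f} (λ e → contradiction (trans (sym e₀) e) λ ()) lb
... | just _ | nothing with refl ← e =
  Fin.zero , refl , e₀ ,
  ActiveLowerBound-∷ {k} {f = f} (λ e → ≤-reflexive (just-injective (trans (sym e₀) e)))
                     (λ x e → contradiction (trans (sym (smallestActive-nothing e₁ x)) e) λ ())
... | just a | just (_ , v) with v <ᵇ a in v<ᵇa
...   | true with refl ← e with j , j≡ , act , lb ← smallestActive-tabulate⁻ e₁ =
  Fin.suc j , cong suc j≡ , act ,
  ActiveLowerBound-∷ {k} {f = f} (λ e → <⇒≤ (subst (v <_) (just-injective (trans (sym e₀) e)) (<ᵇ-true⇒< v<ᵇa))) lb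
...   | false with refl ← e with _ , _ , _ , lb ← smallestActive-tabulate⁻ e₁ =
  Fin.zero , refl , e₀ ,
  ActiveLowerBound-∷ {k} {f = f} (λ e → ≤-reflexive (just-injective (trans (sym e₀) e)))
                     (λ x e → ≤-trans (<ᵇ-false⇒≥ v<ᵇa) (lb x e))

smallestActive-tabulate : ∀ {k n} {f : Fin n → List ℕ} j {v} → activeEntry k (f j) ≡ just v →
  (∀ x {a} → x ≢ j → activeEntry k (f x) ≡ just a → v < a) → smallestActive k (tabulate f) ≡ just (toℕ j , v)
smallestActive-tabulate {k} {suc n} {f} Fin.zero act smaller
  with activeEntry k (f Fin.zero) | smallestActive k (tabulate (f ∘ Fin.suc)) in e₁
... | just _ | nothing = cong (λ a → just (0 , a)) (just-injective act)
... | just a | just (_ , v′) with refl ← act with v′ <ᵇ a in v′<ᵇa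
...   | false = refl
...   | true with j , _ , act′ , _ ← smallestActive-tabulate⁻ e₁ =
  contradiction (<ᵇ-true⇒< v′<ᵇa) (<-asym (smaller (Fin.suc j) (λ ()) act′))
smallestActive-tabulate {k} {suc n} {f} (Fin.suc j) {v} act smaller
  with activeEntry k (f Fin.zero) in e₀
     | smallestActive-tabulate {f = f ∘ Fin.suc} j act (λ x x≢j → smaller (Fin.suc x) (x≢j ∘ Fin-suc-injective))
... | nothing | rest rewrite rest = refl
... | just a  | rest rewrite rest with v <ᵇ a in v<ᵇa
...   | true  = refl
...   | false = contradiction (smaller Fin.zero (λ ()) e₀) (≤⇒≯ (<ᵇ-false⇒≥ v<ᵇa))

#entries : Columns → ℕ
#entries = sum ∘ map length

#occupied : Columns → ℕ
#occupied []             = 0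
#occupied ([] ∷ cs)      = #occupied cs
#occupied ((_ ∷ _) ∷ cs) = suc (#occupied cs)

#entries-appendAt : ∀ {n} (f : Fin n → List ℕ) (j : Fin n) i →
  #entries (appendAt (toℕ j) i (tabulate f)) ≡ suc (#entries (tabulate f))
#entries-appendAt f Fin.zero    i = cong (_+ _) (trans (length-++ (f Fin.zero)) (+-comm _ 1))
#entries-appendAt f (Fin.suc j) i =
  trans (cong (length (f Fin.zero) +_) (#entries-appendAt (f ∘ Fin.suc) j i)) (+-suc _ _)

#occupied-appendAt-[] : ∀ {n} (f : Fin n → List ℕ) (j : Fin n) i → f j ≡ [] →
  #occupied (appendAt (toℕ j) i (tabulate f)) ≡ suc (#occupied (tabulate f))
#occupied-appendAt-[] f Fin.zero    i fj≡[] rewrite fj≡[] = refl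
#occupied-appendAt-[] f (Fin.suc j) i fj≡[] with f Fin.zero | #occupied-appendAt-[] (f ∘ Fin.suc) j i fj≡[]
... | []    | ih = ih
... | _ ∷ _ | ih = cong suc ih

#occupied-appendAt-∷ : ∀ {n} (f : Fin n → List ℕ) (j : Fin n) i → f j ≢ [] →
  #occupied (appendAt (toℕ j) i (tabulate f)) ≡ #occupied (tabulate f)
#occupied-appendAt-∷ f Fin.zero    i fj≢[] with f Fin.zero
... | []    = contradiction refl fj≢[]
... | _ ∷ _ = refl
#occupied-appendAt-∷ f (Fin.suc j) i fj≢[] with f Fin.zero | #occupied-appendAt-∷ (f ∘ Fin.suc) j i fj≢[]
... | []    | ih = ih
... | _ ∷ _ | ih = cong suc ih

#entries≤ : ∀ {h} cs → All (λ c → length c ≤ h) cs → #entries cs ≤ h * #occupied cs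
#entries≤         []             []          = z≤n
#entries≤         ([] ∷ cs)      (_ ∷ lens)  = #entries≤ cs lens
#entries≤ {h} (c@(_ ∷ _) ∷ cs) (len ∷ lens) =
  subst (length c + #entries cs ≤_) (sym (*-suc h (#occupied cs))) (+-mono-≤ len (#entries≤ cs lens))

#entries-[] : ∀ cs → All (_≡ []) cs → #entries cs ≡ 0
#entries-[] []       []          = refl
#entries-[] (_ ∷ cs) (refl ∷ es) = #entries-[] cs es

#occupied-[] : ∀ cs → All (_≡ []) cs → #occupied cs ≡ 0
#occupied-[] []       []          = refl
#occupied-[] (_ ∷ cs) (refl ∷ es) = #occupied-[] cs es

#entries-full : ∀ {h} cs → All (λ c → length c ≡ h) cs → #entries cs ≡ length cs * h
#entries-full []       []          = refl
#entries-full (_ ∷ cs) (len ∷ lens) = cong₂ _+_ len (#entries-full cs lens)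

#occupied-full : ∀ cs → All (_≢ []) cs → #occupied cs ≡ length cs
#occupied-full []            []          = refl
#occupied-full ([] ∷ _)      (c≢[] ∷ _)  = contradiction refl c≢[]
#occupied-full ((_ ∷ _) ∷ cs) (_ ∷ ne)   = cong suc (#occupied-full cs ne)

toLetter : Step → Letter
toLetter N = S
toLetter E = W

SW≡map : ∀ {m n} (D : Dyck m n) → SW D ≡ map toLetter (proj₁ D)
SW≡map (w , _) = map-cong (λ { N → refl ; E → refl }) w

#N-++ : ∀ xs ys → #N (xs ++ ys) ≡ #N xs + #N ys
#N-++ []       ys = refl
#N-++ (N ∷ xs) ys = cong suc (#N-++ xs ys)
#N-++ (E ∷ xs) ys = #N-++ xs ys

#E-++ : ∀ xs ys → #E (xs ++ ys) ≡ #E xs + #E ys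
#E-++ []       ys = refl
#E-++ (N ∷ xs) ys = #E-++ xs ys
#E-++ (E ∷ xs) ys = cong suc (#E-++ xs ys)

-- The prefix condition of IsDyck for a word that continues a path already at (a , b).
Above : ℕ → ℕ → ℕ → ℕ → List Step → Set
Above m n a b w = ∀ p q → w ≡ p ++ q → n * (a + #E p) ≤ m * (b + #N p)

Above-[] : ∀ {m n a b} → n * a ≤ m * b → Above m n a b []
Above-[] {a = a} {b} na≤mb [] _ _ rewrite +-identityʳ a | +-identityʳ b = na≤mb

Above-N : ∀ {m n a b w} → n * a ≤ m * b → Above m n a (suc b) w → Above m n a b (N ∷ w)
Above-N {a = a} {b} na≤mb _ [] _ _ rewrite +-identityʳ a | +-identityʳ b = na≤mb
Above-N {b = b} _ above (N ∷ p) q refl rewrite +-suc b (#N p) = above p q refl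

Above-E : ∀ {m n a b w} → n * a ≤ m * b → Above m n (suc a) b w → Above m n a b (E ∷ w)
Above-E {a = a} {b} na≤mb _ [] _ _ rewrite +-identityʳ a | +-identityʳ b = na≤mb
Above-E {a = a} _ above (E ∷ p) q refl rewrite +-suc a (#E p) = above p q refl

module Standard {k n′ : ℕ} (T : Array k (suc n′)) (std : IsStandard T) where
  open IsStandard std

  n : ℕ
  n = suc n′

  #labels : ℕ
  #labels = suc k * n

  column : Fin n → List ℕ
  column x = tabulate (λ r → T r x)

  columns : Columns
  columns = tabulate column

  columnsOf≡columns : columnsOf T ≡ columns
  columnsOf≡columns =
    trans (toList-tabulate (λ x → Vec.toList (Vec.tabulate (λ r → T r x))))
          (tabulate-cong (λ x → toList-tabulate (λ r → T r x)))

  column-increasing : ∀ x → Increasing (λ r → T r x)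
  column-increasing x = colsInc _ _ x

  row-increasing : ∀ r → Increasing (T r)
  row-increasing r = rowsInc r _ _

  upper<lower : ∀ r j → T (inject₁ r) j < T (Fin.suc r) j
  upper<lower r j = column-increasing j (s≤s (≤-reflexive (toℕ-inject₁ r)))

  T₀₀≡1 : T Fin.zero Fin.zero ≡ 1
  T₀₀≡1 with r , j , Trj≡1 ← surjective 1 ≤-refl (s≤s z≤n) =
    ≤-antisym (≤-trans (Increasing-mono (row-increasing Fin.zero) z≤n)
                       (≤-trans (Increasing-mono (column-increasing j) z≤n) (≤-reflexive Trj≡1)))
              (proj₁ (inRange Fin.zero Fin.zero))

  2≤T : ∀ r c → ¬ (r ≡ Fin.zero × c ≡ Fin.zero) → 2 ≤ T r c
  2≤T r c not-corner =
    ≤∧≢⇒< (proj₁ (inRange r c)) (λ 1≡Trc → not-corner (injective r c _ _ (trans (sym 1≡Trc) (sym T₀₀≡1))))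

  restrictedColumn : ℕ → Fin n → List ℕ
  restrictedColumn i x = below i (column x)

  restriction : ℕ → Columns
  restriction i = tabulate (restrictedColumn i)

  restriction-step : ∀ {r j i} → T r j ≡ i → restriction (suc i) ≡ appendAt (toℕ j) i (restriction i)
  restriction-step {r} {j} refl = sym (appendAt-tabulate j (below-suc-tabulate (column-increasing j) r) unchanged)
    where
    unchanged : ∀ x → x ≢ j → restrictedColumn (suc (T r j)) x ≡ restrictedColumn (T r j) x
    unchanged x x≢j = below-suc-∉ (column x) λ Trj∈ →
      let p , Trj≡Tpx = ∈-tabulate⁻ {f = λ r → T r x} Trj∈ in x≢j (sym (proj₂ (injective r j p x Trj≡Tpx)))

  restriction-complete : restriction (suc #labels) ≡ columns
  restriction-complete = tabulate-cong (λ x → below-all (λ p → s≤s (proj₂ (inRange p x))))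

  restriction-1 : All (_≡ []) (restriction 1)
  restriction-1 = tabulate⁺ (λ x → below-none (λ p → proj₁ (inRange p x)))

  restriction-2 : restriction 2 ≡ initial n
  restriction-2 = cong₂ _∷_ first (trans (tabulate-cong others) (tabulate-const []))
    where
    first : restrictedColumn 2 Fin.zero ≡ [ 1 ]
    first rewrite below-∷ (tabulate (λ r → T (Fin.suc r) Fin.zero)) (≤-reflexive (cong suc T₀₀≡1))
                | below-none {g = λ r → T (Fin.suc r) Fin.zero} (λ r → 2≤T (Fin.suc r) Fin.zero λ ())
                | T₀₀≡1 = refl
    others : ∀ x → restrictedColumn 2 (Fin.suc x) ≡ []
    others x = below-none (λ r → 2≤T r (Fin.suc x) λ ())

  active-restriction : ∀ {c} r j → T (inject₁ r) j < c → c ≤ T (Fin.suc r) j →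
    activeEntry k (restrictedColumn c j) ≡ just (T (inject₁ r) j)
  active-restriction {c} r j lo hi with len , lst ← below-last (column-increasing j) r lo hi =
    activeEntry⁺ {c = restrictedColumn c j} (subst (_≤ k) (sym len) (toℕ<n r)) lst

  active-restriction⁻ : ∀ {c a} x → activeEntry k (restrictedColumn c x) ≡ just a →
    ∃[ s ] T (inject₁ s) x ≡ a × c ≤ T (Fin.suc s) x
  active-restriction⁻ {c} x act with len , lst ← activeEntry⁻ {k} {restrictedColumn c x} act =
    below-last⁻ (column-increasing x) len lst

  UpperNeighbourSmallest : ℕ → Set
  UpperNeighbourSmallest c =
    ∀ r j → T (Fin.suc r) j ≡ c → ActiveLowerBound k (restrictedColumn c) (T (inject₁ r) j)

  FillsFrom : ℕ → List Letter → Set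
  FillsFrom i ls = run k i ls (restriction i) ≡ just columns

  fills-S⁻ : ∀ {i ls} → FillsFrom i (S ∷ ls) → UpperNeighbourSmallest i × FillsFrom (suc i) ls
  fills-S⁻ {i} {ls} e
    with _ , placed , rest ← run-S⁻ {k} {i} {ls} {restriction i} {columns} e
    with j , empty , refl ← placeS-tabulate⁻ {i = i} {f = restrictedColumn i} placed
    with tail , final ← appendAt-⊑ᶜ-tabulate⁻ {f = restrictedColumn i} {g = column} j (run-⊑ᶜ {k} {suc i} ls rest) =
    (λ r j′ e′ → contradiction (proj₁ (injective _ _ _ _ (trans e′ (sym top)))) λ ()) ,
    subst (λ cs → run k (suc i) ls cs ≡ just columns) (sym (restriction-step top)) rest
    where
    top : T Fin.zero j ≡ i
    top = ∷-injectiveˡ (trans final (cong (_++ i ∷ tail) empty))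

  fills-W⁻ : ∀ {i ls} → FillsFrom i (W ∷ ls) → UpperNeighbourSmallest i × FillsFrom (suc i) ls
  fills-W⁻ {i} {ls} e
    with _ , placed , rest ← run-W⁻ {k} {i} {ls} {restriction i} {columns} e
    with _ , v , smallest , refl ← placeW⁻ {k} {i} {restriction i} placed
    with j , refl , active , lowerBound ← smallestActive-tabulate⁻ {k} {f = restrictedColumn i} smallest
    with tail , final ← appendAt-⊑ᶜ-tabulate⁻ {f = restrictedColumn i} {g = column} j (run-⊑ᶜ {k} {suc i} ls rest)
    with p , i≡Tpj ← ∈-tabulate⁻ {f = λ r → T r j}
                       (subst (i ∈_) (sym final) (∈-++⁺ʳ (restrictedColumn i j) (here refl))) =
    upperNeighbourSmallest ,
    subst (λ cs → run k (suc i) ls cs ≡ just columns) (sym (restriction-step (sym i≡Tpj))) rest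
    where
    upperNeighbourSmallest : UpperNeighbourSmallest i
    upperNeighbourSmallest r j′ e′ with refl ← proj₂ (injective _ _ _ _ (trans e′ i≡Tpj)) =
      subst (ActiveLowerBound k (restrictedColumn i)) (just-injective (trans (sym active) upper-active)) lowerBound
      where
      upper-active : activeEntry k (restrictedColumn i j) ≡ just (T (inject₁ r) j)
      upper-active = active-restriction r j (subst (_ <_) e′ (upper<lower r j)) (≤-reflexive (sym e′))

  fills⁻ : ∀ {i l ls} → FillsFrom i (l ∷ ls) → UpperNeighbourSmallest i × FillsFrom (suc i) ls
  fills⁻ {l = S} = fills-S⁻
  fills⁻ {l = W} = fills-W⁻

  fills⇒upperNeighbourSmallest : ∀ {i} ls → FillsFrom i ls → ∀ {c} → i ≤ c → UpperNeighbourSmallest c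
  fills⇒upperNeighbourSmallest {i} [] e i≤c r j refl =
    contradiction i≤c (<⇒≱ (below-all⁻ {g = λ r → T r j} complete (Fin.suc r)))
    where
    complete : restrictedColumn i j ≡ column j
    complete = tabulate-injective {f = restrictedColumn i} {g = column} (just-injective e) j
  fills⇒upperNeighbourSmallest (l ∷ ls) e i≤c with fills⁻ {l = l} e | m≤n⇒m<n∨m≡n i≤c
  ... | atI , _    | inj₂ refl = atI
  ... | _   , rest | inj₁ i<c  = fills⇒upperNeighbourSmallest ls rest i<c

  upperNeighbourSmallest⇒patternCondition : (∀ {c} → 2 ≤ c → UpperNeighbourSmallest c) → PatternCondition T
  upperNeighbourSmallest⇒patternCondition _ r j rb Fin.zero cb .cb a<b b<c c<d refl =
    <⇒≱ b<c (Increasing-mono (column-increasing cb) z≤n)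
  upperNeighbourSmallest⇒patternCondition uns r j rb (Fin.suc rc) cb .cb a<b b<c c<d refl =
    -- when c was placed, a was active, so the entry above c, which is at least b, was at most a
    <⇒≱ a<b (≤-trans b≤upper upper≤a)
    where
    upper≤a : T (inject₁ rc) cb ≤ T (inject₁ r) j
    upper≤a = uns (≤-trans (s≤s (proj₁ (inRange (inject₁ r) j))) (<-trans a<b b<c)) rc cb refl j
                  (active-restriction r j (<-trans a<b b<c) (<⇒≤ c<d))
    b≤upper : T rb cb ≤ T (inject₁ rc) cb
    b≤upper = Increasing-mono (column-increasing cb)
                (subst (toℕ rb ≤_) (sym (toℕ-inject₁ rc)) (≤-pred (Increasing-cancel (column-increasing cb) b<c)))

  readingStep : ℕ → Step
  readingStep i with any? (λ j → T Fin.zero j ≟ i)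
  ... | yes _ = N
  ... | no _  = E

  readingStep-top : ∀ {i} j → T Fin.zero j ≡ i → readingStep i ≡ N
  readingStep-top {i} j top with any? (λ j → T Fin.zero j ≟ i)
  ... | yes _    = refl
  ... | no ¬top  = contradiction (j , top) ¬top

  readingStep-lower : ∀ {i} r j → T (Fin.suc r) j ≡ i → readingStep i ≡ E
  readingStep-lower {i} r j lower with any? (λ j → T Fin.zero j ≟ i)
  ... | no _             = refl
  ... | yes (j′ , top) with () ← proj₁ (injective _ _ _ _ (trans top (sym lower)))

  readingWord : ℕ → ℕ → List Step
  readingWord i zero      = []
  readingWord i (suc len) = readingStep i ∷ readingWord (suc i) len

  restrictedColumn-empty : ∀ {i} x → i ≤ T Fin.zero x → restrictedColumn i x ≡ []
  restrictedColumn-empty x i≤top =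
    below-none (λ r → ≤-trans i≤top (Increasing-mono (column-increasing x) {Fin.zero} {r} z≤n))

  restrictedColumn-occupied : ∀ {i} x → T Fin.zero x < i → restrictedColumn i x ≢ []
  restrictedColumn-occupied x top<i rewrite below-∷ (tabulate (λ r → T (Fin.suc r) x)) top<i = λ ()

  placeS-top : ∀ {i} j → T Fin.zero j ≡ i → placeS i (restriction i) ≡ just (restriction (suc i))
  placeS-top j top =
    trans (placeS-tabulate j (restrictedColumn-empty j (≤-reflexive (sym top)))
                             (λ x x<j → restrictedColumn-occupied x (subst (_ <_) top (row-increasing Fin.zero x<j))))
          (cong just (sym (restriction-step top)))

  smallestActive-lower : PatternCondition T → ∀ {i} r j → T (Fin.suc r) j ≡ i →
    smallestActive k (restriction i) ≡ just (toℕ j , T (inject₁ r) j)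
  smallestActive-lower pc {i} r j lower =
    smallestActive-tabulate {f = restrictedColumn i} j (active-restriction r j upper<i (≤-reflexive (sym lower))) smaller
    where
    upper<i : T (inject₁ r) j < i
    upper<i = subst (_ <_) lower (upper<lower r j)
    smaller : ∀ x {a} → x ≢ j → activeEntry k (restrictedColumn i x) ≡ just a → T (inject₁ r) j < a
    smaller x {a} x≢j act with s , Tsx≡a , i≤Ts′x ← active-restriction⁻ x act with <-cmp (T (inject₁ r) j) a
    ... | tri< lt _ _ = lt
    ... | tri≈ _ eq _ = contradiction (sym (proj₂ (injective _ _ _ _ (trans eq (sym Tsx≡a))))) x≢j
    -- an active entry below the upper neighbour would complete a forbidden pattern with it
    ... | tri> _ _ gt = contradiction refl
      (pc s x (inject₁ r) (Fin.suc r) j j (subst (_< _) (sym Tsx≡a) gt) (subst (_ <_) (sym lower) upper<i)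
          (subst (_< T (Fin.suc s) x) (sym lower) i<Ts′x))
      where
      i<Ts′x : i < T (Fin.suc s) x
      i<Ts′x = ≤∧≢⇒< i≤Ts′x (λ i≡ → x≢j (proj₂ (injective _ _ _ _ (trans (sym i≡) (sym lower)))))

  placeW-lower : PatternCondition T → ∀ {i} r j → T (Fin.suc r) j ≡ i →
    placeW k i (restriction i) ≡ just (restriction (suc i))
  placeW-lower pc r j lower =
    trans (placeW⁺ (smallestActive-lower pc r j lower)) (cong just (sym (restriction-step lower)))

  labelPosition : ∀ {i len} → 1 ≤ i → i + suc len ≡ suc #labels → ∃[ r ] ∃[ j ] T r j ≡ i
  labelPosition {i} {len} 1≤i e =
    surjective i 1≤i (≤-pred (subst (suc i ≤_) (trans (sym (+-suc i len)) e) (s≤s (m≤m+n i len))))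

  run-readingStep : PatternCondition T → ∀ {i} r j → T r j ≡ i → ∀ {ls R} →
    run k (suc i) ls (restriction (suc i)) ≡ R → run k i (toLetter (readingStep i) ∷ ls) (restriction i) ≡ R
  run-readingStep pc {i} Fin.zero    j top   {ls} rest rewrite readingStep-top j top =
    run-S {k} {i} {ls} {restriction i} {restriction (suc i)} (placeS-top j top) rest
  run-readingStep pc {i} (Fin.suc r) j lower {ls} rest rewrite readingStep-lower r j lower =
    run-W {k} {i} {ls} {restriction i} {restriction (suc i)} (placeW-lower pc r j lower) rest

  readingWord-fills : PatternCondition T → ∀ len {i} → 1 ≤ i → i + len ≡ suc #labels →
    run k i (map toLetter (readingWord i len)) (restriction i) ≡ just (restriction (suc #labels))
  readingWord-fills pc zero {i} _ e rewrite +-identityʳ i | e = refl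
  readingWord-fills pc (suc len) {i} 1≤i e with r , j , Trj≡i ← labelPosition 1≤i e =
    run-readingStep pc r j Trj≡i (readingWord-fills pc len (s≤s z≤n) (trans (sym (+-suc i len)) e))

  M : ℕ
  M = suc (k * n)

  Counted : ℕ → ℕ → ℕ → Set
  Counted i a b = #entries (restriction i) ≡ a + b × #occupied (restriction i) ≡ b

  counted-1 : Counted 1 0 0
  counted-1 = #entries-[] (restriction 1) restriction-1 , #occupied-[] (restriction 1) restriction-1

  counted-top : ∀ {i a b} j → T Fin.zero j ≡ i → Counted i a b → Counted (suc i) a (suc b)
  counted-top {i} {a} {b} j top (entries , occupied) =
    trans (cong #entries (restriction-step top))
          (trans (#entries-appendAt (restrictedColumn i) j i) (trans (cong suc entries) (sym (+-suc a b)))) ,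
    trans (cong #occupied (restriction-step top))
          (trans (#occupied-appendAt-[] (restrictedColumn i) j i (restrictedColumn-empty j (≤-reflexive (sym top))))
                 (cong suc occupied))

  counted-lower : ∀ {i a b} r j → T (Fin.suc r) j ≡ i → Counted i a b → Counted (suc i) (suc a) b
  counted-lower {i} r j lower (entries , occupied) =
    trans (cong #entries (restriction-step lower)) (trans (#entries-appendAt (restrictedColumn i) j i) (cong suc entries)) ,
    trans (cong #occupied (restriction-step lower))
          (trans (#occupied-appendAt-∷ (restrictedColumn i) j i occupied′) occupied)
    where
    occupied′ : restrictedColumn i j ≢ []
    occupied′ = restrictedColumn-occupied j (subst (_ <_) lower (column-increasing j {Fin.zero} {Fin.suc r} (s≤s z≤n)))

  counted⇒above : ∀ {i a b} → Counted i a b → n * a ≤ M * b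
  counted⇒above {i} {a} {b} (entries , occupied) = begin
    n * a       ≤⟨ *-monoʳ-≤ n a≤kb ⟩
    n * (k * b) ≡⟨ trans (sym (*-assoc n k b)) (cong (_* b) (*-comm n k)) ⟩
    k * n * b   ≤⟨ m≤n+m (k * n * b) b ⟩
    M * b       ∎
    where
    open ≤-Reasoning
    short : All (λ c → length c ≤ suc k) (restriction i)
    short = tabulate⁺ {f = restrictedColumn i}
      (λ x → ≤-trans (length-filter (_<? i) (column x)) (≤-reflexive (length-tabulate (λ r → T r x))))
    a+b≤k+1*b : a + b ≤ suc k * b
    a+b≤k+1*b = subst₂ _≤_ entries (cong (suc k *_) occupied) (#entries≤ (restriction i) short)
    a≤kb : a ≤ k * b
    a≤kb = +-cancelʳ-≤ b a (k * b) (subst (a + b ≤_) (+-comm b (k * b)) a+b≤k+1*b)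

  #entries-columns : #entries columns ≡ n * suc k
  #entries-columns =
    trans (#entries-full columns (tabulate⁺ {f = column} (λ x → length-tabulate (λ r → T r x))))
          (cong (_* suc k) (length-tabulate column))

  #occupied-columns : #occupied columns ≡ n
  #occupied-columns = trans (#occupied-full columns (tabulate⁺ {f = column} (λ x → λ ()))) (length-tabulate column)

  counted-complete : ∀ {a b} → Counted (suc #labels) a b → a ≡ k * n × b ≡ n
  counted-complete {a} {b} (entries , occupied) = a≡kn , b≡n
    where
    open ≡-Reasoning
    b≡n : b ≡ n
    b≡n = trans (sym occupied) (trans (cong #occupied restriction-complete) #occupied-columns)
    a≡kn : a ≡ k * n
    a≡kn = +-cancelʳ-≡ n a (k * n) (begin
      a + n                                ≡⟨ cong (a +_) b≡n ⟨
      a + b                                ≡⟨ entries ⟨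
      #entries (restriction (suc #labels)) ≡⟨ cong #entries restriction-complete ⟩
      #entries columns                     ≡⟨ #entries-columns ⟩
      n * suc k                            ≡⟨ *-comm n (suc k) ⟩
      n + k * n                            ≡⟨ +-comm n (k * n) ⟩
      k * n + n                            ∎)

  readingWord-dyck : ∀ len {i a b} → 1 ≤ i → i + len ≡ suc #labels → Counted i a b →
    Above M n a b (readingWord i len ++ [ E ]) × #N (readingWord i len) + b ≡ n × #E (readingWord i len) + a ≡ k * n
  readingWord-dyck zero {i} {a} {b} _ e counted with refl ← trans (sym (+-identityʳ i)) e
    with a≡kn , b≡n ← counted-complete counted =
    Above-E {M} {n} {a} {b} (counted⇒above {i} counted) (Above-[] {M} {n} {suc a} {b} (≤-reflexive final)) , b≡n , a≡kn
    where
    final : n * suc a ≡ M * b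
    final = trans (cong (λ x → n * suc x) a≡kn) (trans (*-comm n M) (cong (M *_) (sym b≡n)))
  readingWord-dyck (suc len) {i} {a} {b} 1≤i e counted with labelPosition 1≤i e
  ... | Fin.zero , j , top rewrite readingStep-top j top
    with above , north , east ← readingWord-dyck len (s≤s z≤n) (trans (sym (+-suc i len)) e) (counted-top j top counted) =
    Above-N {M} {n} {a} {b} (counted⇒above {i} counted) above , trans (sym (+-suc _ b)) north , east
  ... | Fin.suc r , j , lower rewrite readingStep-lower r j lower
    with above , north , east ← readingWord-dyck len (s≤s z≤n) (trans (sym (+-suc i len)) e) (counted-lower r j lower counted) =
    Above-E {M} {n} {a} {b} (counted⇒above {i} counted) above , north , trans (sym (+-suc _ a)) east

  readingPath : Dyck M n
  readingPath = readingWord 1 #labels ++ [ E ] , record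
    { east-count  = trans (#E-++ word [ E ]) (trans (+-comm (#E word) 1) (cong suc (trans (sym (+-identityʳ _)) east)))
    ; north-count = trans (#N-++ word [ E ]) (trans (+-identityʳ (#N word)) (trans (sym (+-identityʳ _)) north))
    ; above       = above
    }
    where
    word : List Step
    word = readingWord 1 #labels
    dyck : Above M n 0 0 (word ++ [ E ]) × #N word + 0 ≡ n × #E word + 0 ≡ k * n
    dyck = readingWord-dyck #labels ≤-refl refl counted-1
    above = proj₁ dyck
    north = proj₁ (proj₂ dyck)
    east  = proj₂ (proj₂ dyck)

  length-readingWord : ∀ i len → length (readingWord i len) ≡ len
  length-readingWord i zero      = refl
  length-readingWord i (suc len) = cong suc (length-readingWord (suc i) len)

  fills-readingPath : PatternCondition T → T[_] {k} {n} readingPath ≡ just (columnsOf T)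
  fills-readingPath pc = begin
    run k 2 (take (M + n ∸ 2) (drop 1 (SW readingPath))) (initial n)
      ≡⟨ cong (λ ls → run k 2 (take (M + n ∸ 2) (drop 1 ls)) (initial n)) (SW≡map readingPath) ⟩
    run k 2 (take (M + n ∸ 2) (map toLetter (word ++ [ E ]))) (initial n)
      ≡⟨ cong₂ (run k 2) (trans (take-map (M + n ∸ 2) (word ++ [ E ])) (cong (map toLetter) take≡))
                         (sym restriction-2) ⟩
    run k 2 (map toLetter word) (restriction 2)
      ≡⟨ readingWord-fills pc (n′ + k * n) (s≤s z≤n) refl ⟩
    just (restriction (suc #labels))
      ≡⟨ cong just (trans restriction-complete (sym columnsOf≡columns)) ⟩
    just (columnsOf T) ∎
    where
    open ≡-Reasoning
    word : List Step
    word = readingWord 2 (n′ + k * n)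
    length-word : M + n ∸ 2 ≡ length word
    length-word =
      trans (cong (_∸ 1) (+-suc (k * n) n′)) (trans (+-comm (k * n) n′) (sym (length-readingWord 2 (n′ + k * n))))
    take≡ : take (M + n ∸ 2) (word ++ [ E ]) ≡ word
    take≡ = trans (cong (λ t → take t (word ++ [ E ])) length-word) (take-length-++ word [ E ])

  fills⇒patternCondition : (D : Dyck M n) → T[_] {k} {n} D ≡ just (columnsOf T) → PatternCondition T
  fills⇒patternCondition D e =
    upperNeighbourSmallest⇒patternCondition (fills⇒upperNeighbourSmallest letters fills₂)
    where
    letters : List Letter
    letters = take (M + n ∸ 2) (drop 1 (SW D))
    fills₂ : FillsFrom 2 letters
    fills₂ = subst₂ (λ cs F → run k 2 letters cs ≡ just F) (sym restriction-2) columnsOf≡columns e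

lemma2p7 : ∀ (k n : ℕ) → 1 ≤ k → 1 ≤ n → (T : Array k n) → IsStandard T →
    ((∃[ D ] (T[_] {k} {n} D ≡ just (columnsOf T))) ⇔ PatternCondition T)
lemma2p7 k zero     _ () T std
lemma2p7 k (suc n′) _ _  T std =
  mk⇔ (λ (D , e) → fills⇒patternCondition D e) (λ pc → readingPath , fills-readingPath pc)
  where open Standard T std
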